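{- Let $T_1,T_2$ be planar rooted trees, each with $n$ non-root nodes, and let $R_1=\rho(T_1)$, $R_2=\rho(T_2)$. Then $T_1\leq_T T_2$ if and only if, for every $k\in\{1,\dots,n\}$, $R_1(k)\supseteq R_2(k)$.
   Context: In a planar (ordered) rooted tree the nodes are labelled by the preorder traversal (root first, then recursively the subtrees of its children from left to right), the root getting label $0$ and the non-root nodes labels $1,\dots,n$; nodes of different trees are identified via their labels. For such a tree $T$, $\rho(T)$ is the strict partial order $R$ on $\{1,\dots,n\}$ with $xRy$ iff neither of $x,y$ is an ancestor of the other and $x$ lies to the left of $y$ in $T$. For a relation $R$, $R(k)=\{y: kRy\}$. For a node $k$, $u_T(k)$ denotes the set of (proper) descendants of $k$ in $T$. The Tamari order: $T_1\leq_T T_2$ iff $|u_{T_1}(k)|\leq|u_{T_2}(k)|$ for every node $k$. -}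

module Defs where

open import Data.Nat using (ℕ; zero; suc; _≤_; _<ᵇ_; _≡ᵇ_; _∸_)
open import Data.Bool using (Bool; true; false; _∧_; _∨_)
open import Data.List using (List; []; _∷_; _++_; map; length; filterᵇ)
open import Data.Maybe using (Maybe; just; nothing; maybe)
open import Data.Product using (Σ; _×_; ∃-syntax)
open import Relation.Binary.PropositionalEquality using (_≡_)

data Tree : Set where
  node : List Tree → Tree

-- Address of a node = path of child indices (0-based, left to right) from the root.
Addr : Set
Addr = List ℕ

-- All node addresses in preorder (root first, then subtrees of children left to right).
-- Hence the node with preorder label k is the k-th entry (0-based) of this list.
mutual
  preorder : Tree → List Addr
  preorder (node ts) = [] ∷ preorderF 0 ts

  preorderF : ℕ → List Tree → List Addr
  preorderF i [] = []
  preorderF i (t ∷ ts) = map (i ∷_) (preorder t) ++ preorderF (suc i) ts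

-- number of non-root nodes
size : Tree → ℕ
size t = length (preorder t) ∸ 1

nth : {A : Set} → List A → ℕ → Maybe A
nth [] _ = nothing
nth (x ∷ xs) zero = just x
nth (x ∷ xs) (suc k) = nth xs k

addrOf : Tree → ℕ → Maybe Addr
addrOf t k = nth (preorder t) k

isProperAncestor : Addr → Addr → Bool
isProperAncestor [] [] = false
isProperAncestor [] (_ ∷ _) = true
isProperAncestor (_ ∷ _) [] = false
isProperAncestor (x ∷ xs) (y ∷ ys) = (x ≡ᵇ y) ∧ isProperAncestor xs ys

isLeftOf : Addr → Addr → Bool
isLeftOf [] _ = false
isLeftOf (_ ∷ _) [] = false
isLeftOf (x ∷ xs) (y ∷ ys) = (x <ᵇ y) ∨ ((x ≡ᵇ y) ∧ isLeftOf xs ys)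

ρ : Tree → ℕ → ℕ → Set
ρ t x y = Σ Addr λ ax → Σ Addr λ ay →
  (addrOf t x ≡ just ax) × (addrOf t y ≡ just ay) ×
  (1 ≤ x) × (1 ≤ y) ×
  (isProperAncestor ax ay ≡ false) × (isProperAncestor ay ax ≡ false) ×
  (isLeftOf ax ay ≡ true)

-- |u_T(k)| : number of proper descendants of the node labelled k (0 if no such node)
descCount : Tree → ℕ → ℕ
descCount t k = maybe (λ a → length (filterᵇ (isProperAncestor a) (preorder t))) 0 (addrOf t k)

_≤T_ : Tree → Tree → Set
t₁ ≤T t₂ = ∀ k → k ≤ size t₁ → descCount t₁ k ≤ descCount t₂ k

_⟨_⟩⊇_⟨_⟩ : (ℕ → ℕ → Set) → ℕ → (ℕ → ℕ → Set) → ℕ → Set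
R ⟨ k ⟩⊇ R' ⟨ k' ⟩ = ∀ y → R' k' y → R k y

-- In preorder the descendants of the node labelled k are exactly the labels
-- k+1, …, k+|u(k)|, and every later label lies to the right of k while every
-- earlier one is an ancestor of k or lies to its left.  Hence ρ(T)(k) is the
-- final segment {y : k+|u(k)| < y ≤ n}, and for such segments inclusion
-- R₁(k) ⊇ R₂(k) is the same as |u_{T₁}(k)| ≤ |u_{T₂}(k)|.  At the root both
-- counts are n.
module Submission where

open import Defs
open import Data.Bool using (true; false; T; T?)
open import Data.Bool.Properties using (T-≡; T-∧; T-∨; ¬-not)
open import Data.Empty using (⊥-elim)
open import Data.List using (List; []; _∷_; length; filter)
open import Data.List.Properties using (length-filter; filter-accept; filter-reject; filter-none; filter-all)
open import Data.List.Relation.Unary.All as All using (All; []; _∷_)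
open import Data.List.Relation.Unary.All.Properties using () renaming (++⁺ to All-++⁺; map⁺ to All-map⁺)
open import Data.List.Relation.Unary.AllPairs as AllPairs using (AllPairs; []; _∷_)
open import Data.List.Relation.Unary.AllPairs.Properties using () renaming (++⁺ to AllPairs-++⁺; map⁺ to AllPairs-map⁺)
open import Data.Maybe using (just; maybe)
open import Data.Nat using (ℕ; zero; suc; _+_; _≤_; _<_; z≤n; s≤s; s<s; s≤s⁻¹; s<s⁻¹)
open import Data.Nat.Properties
open import Data.Product using (∃; _×_; _,_; uncurry)
open import Data.Sum using (_⊎_; inj₁; inj₂)
open import Function using (_∘_)
open import Function.Bundles using (_⇔_; mk⇔; Equivalence)
open import Relation.Binary.Definitions using (tri<; tri≈; tri>)
open import Relation.Binary.PropositionalEquality using (_≡_; refl; sym; trans; cong; subst)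
open import Relation.Nullary using (¬_)

open Equivalence using (to; from)

data Ancestor : Addr → Addr → Set where
  here  : ∀ {y ys} → Ancestor [] (y ∷ ys)
  there : ∀ {x xs ys} → Ancestor xs ys → Ancestor (x ∷ xs) (x ∷ ys)

data LeftOf : Addr → Addr → Set where
  here  : ∀ {x y xs ys} → x < y → LeftOf (x ∷ xs) (y ∷ ys)
  there : ∀ {x xs ys} → LeftOf xs ys → LeftOf (x ∷ xs) (x ∷ ys)

ancestor-irrefl : ∀ {a} → ¬ Ancestor a a
ancestor-irrefl (there p) = ancestor-irrefl p

ancestor-asym : ∀ {a b} → Ancestor a b → ¬ Ancestor b a
ancestor-asym (there p) (there q) = ancestor-asym p q

leftOf-irrefl : ∀ {a} → ¬ LeftOf a a
leftOf-irrefl (here x<x) = <-irrefl refl x<x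
leftOf-irrefl (there p)  = leftOf-irrefl p

leftOf-trans : ∀ {a b c} → LeftOf a b → LeftOf b c → LeftOf a c
leftOf-trans (here x<y) (here y<z) = here (<-trans x<y y<z)
leftOf-trans (here x<y) (there _)  = here x<y
leftOf-trans (there _)  (here y<z) = here y<z
leftOf-trans (there p)  (there q)  = there (leftOf-trans p q)

leftOf-asym : ∀ {a b} → LeftOf a b → ¬ LeftOf b a
leftOf-asym p q = leftOf-irrefl (leftOf-trans p q)

leftOf-ancestor : ∀ {a b c} → LeftOf a b → Ancestor b c → LeftOf a c
leftOf-ancestor (here x<y) (there _) = here x<y
leftOf-ancestor (there p)  (there q) = there (leftOf-ancestor p q)

leftOf⇒¬ancestor : ∀ {a b} → LeftOf a b → ¬ Ancestor a b
leftOf⇒¬ancestor (here x<x) (there _) = <-irrefl refl x<x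
leftOf⇒¬ancestor (there p)  (there q) = leftOf⇒¬ancestor p q

leftOf⇒¬ancestor˘ : ∀ {a b} → LeftOf a b → ¬ Ancestor b a
leftOf⇒¬ancestor˘ p q = leftOf-irrefl (leftOf-ancestor p q)

Precedes : Addr → Addr → Set
Precedes a b = Ancestor a b ⊎ LeftOf a b

precedes⇒¬ancestor˘ : ∀ {a b} → Precedes a b → ¬ Ancestor b a
precedes⇒¬ancestor˘ (inj₁ p) = ancestor-asym p
precedes⇒¬ancestor˘ (inj₂ p) = leftOf⇒¬ancestor˘ p

precedes⇒¬leftOf˘ : ∀ {a b} → Precedes a b → ¬ LeftOf b a
precedes⇒¬leftOf˘ (inj₁ p) q = leftOf⇒¬ancestor˘ q p
precedes⇒¬leftOf˘ (inj₂ p) q = leftOf-asym p q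

leftOf-precedes : ∀ {a b c} → LeftOf a b → Precedes b c → LeftOf a c
leftOf-precedes p (inj₁ q) = leftOf-ancestor p q
leftOf-precedes p (inj₂ q) = leftOf-trans p q

Sorted : List Addr → Set
Sorted = AllPairs Precedes

T⇒ancestor : ∀ a b → T (isProperAncestor a b) → Ancestor a b
T⇒ancestor []       (_ ∷ _)  _ = here
T⇒ancestor (x ∷ xs) (y ∷ ys) p with to T-∧ p
... | x≡y , q rewrite ≡ᵇ⇒≡ x y x≡y = there (T⇒ancestor xs ys q)

ancestor⇒T : ∀ {a b} → Ancestor a b → T (isProperAncestor a b)
ancestor⇒T here          = _
ancestor⇒T (there {x} p) = from T-∧ (≡⇒≡ᵇ x x refl , ancestor⇒T p)

¬ancestor⇒false : ∀ {a b} → ¬ Ancestor a b → isProperAncestor a b ≡ false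
¬ancestor⇒false {a} {b} ¬p = ¬-not (¬p ∘ T⇒ancestor a b ∘ from T-≡)

false⇒¬ancestor : ∀ {a b} → isProperAncestor a b ≡ false → ¬ Ancestor a b
false⇒¬ancestor e p = subst T e (ancestor⇒T p)

T⇒leftOf : ∀ a b → T (isLeftOf a b) → LeftOf a b
T⇒leftOf (x ∷ xs) (y ∷ ys) p with to T-∨ p
... | inj₁ x<y = here (<ᵇ⇒< x y x<y)
... | inj₂ q with to T-∧ q
...   | x≡y , r rewrite ≡ᵇ⇒≡ x y x≡y = there (T⇒leftOf xs ys r)

leftOf⇒T : ∀ {a b} → LeftOf a b → T (isLeftOf a b)
leftOf⇒T (here x<y)    = from T-∨ (inj₁ (<⇒<ᵇ x<y))
leftOf⇒T (there {x} p) = from T-∨ (inj₂ (from T-∧ (≡⇒≡ᵇ x x refl , leftOf⇒T p)))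

leftOf⇒true : ∀ {a b} → LeftOf a b → isLeftOf a b ≡ true
leftOf⇒true = to T-≡ ∘ leftOf⇒T

true⇒leftOf : ∀ {a b} → isLeftOf a b ≡ true → LeftOf a b
true⇒leftOf {a} {b} = T⇒leftOf a b ∘ from T-≡

count : Addr → List Addr → ℕ
count a L = length (filter (T? ∘ isProperAncestor a) L)

count-accept : ∀ {a b} L → Ancestor a b → count a (b ∷ L) ≡ suc (count a L)
count-accept {a} L p = cong length (filter-accept (T? ∘ isProperAncestor a) (ancestor⇒T p))

count-reject : ∀ {a b} L → ¬ Ancestor a b → count a (b ∷ L) ≡ count a L
count-reject {a} {b} L ¬p = cong length (filter-reject (T? ∘ isProperAncestor a) (¬p ∘ T⇒ancestor a b))

count-none : ∀ {a L} → All (λ b → ¬ Ancestor a b) L → count a L ≡ 0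
count-none {a} ¬ps =
  cong length (filter-none (T? ∘ isProperAncestor a) (All.map (λ ¬p → ¬p ∘ T⇒ancestor _ _) ¬ps))

count≤length : ∀ a L → count a L ≤ length L
count≤length a = length-filter (T? ∘ isProperAncestor a)

nth-All : ∀ {A : Set} {P : A → Set} {xs j b} → All P xs → nth xs j ≡ just b → P b
nth-All {j = zero}  (px ∷ _)   refl = px
nth-All {j = suc j} (_  ∷ pxs) e    = nth-All pxs e

nth-AllPairs : ∀ {A : Set} {R : A → A → Set} {xs i j a b} → AllPairs R xs → i < j →
               nth xs i ≡ just a → nth xs j ≡ just b → R a b
nth-AllPairs {i = zero}  {suc j} (px ∷ _)   _         refl e  = nth-All px e
nth-AllPairs {i = suc i} {suc j} (_  ∷ pxs) (s<s i<j) e₁   e₂ = nth-AllPairs pxs i<j e₁ e₂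

nth-defined : ∀ {A : Set} (xs : List A) {j} → j < length xs → ∃ λ b → nth xs j ≡ just b
nth-defined (x ∷ xs) {zero}  _         = x , refl
nth-defined (x ∷ xs) {suc j} (s<s j<n) = nth-defined xs j<n

nth-index< : ∀ {A : Set} (xs : List A) {j b} → nth xs j ≡ just b → j < length xs
nth-index< (x ∷ xs) {zero}  _ = s≤s z≤n
nth-index< (x ∷ xs) {suc j} e = s<s (nth-index< xs e)

leftOf⇒¬ancestor-all : ∀ {a c L} → LeftOf a c → All (Precedes c) L →
                       All (λ b → ¬ Ancestor a b) (c ∷ L)
leftOf⇒¬ancestor-all a◁c c≺L =
  leftOf⇒¬ancestor a◁c ∷ All.map (leftOf⇒¬ancestor ∘ leftOf-precedes a◁c) c≺L

ancestor⇔index<count : ∀ {a L j b} → Sorted L → All (Precedes a) L →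
                       nth L j ≡ just b → Ancestor a b ⇔ j < count a L
ancestor⇔index<count {L = c ∷ L} {zero} _ (inj₁ a⊏c ∷ _) refl
  rewrite count-accept L a⊏c = mk⇔ (λ _ → s≤s z≤n) (λ _ → a⊏c)
ancestor⇔index<count {L = c ∷ L} {suc j} (_ ∷ sorted) (inj₁ a⊏c ∷ a≺L) e
  rewrite count-accept L a⊏c = mk⇔ (s<s ∘ to IH) (from IH ∘ s<s⁻¹)
  where IH = ancestor⇔index<count sorted a≺L e
ancestor⇔index<count {L = c ∷ L} {j} (c≺L ∷ _) (inj₂ a◁c ∷ _) e
  rewrite count-none (leftOf⇒¬ancestor-all a◁c c≺L)
  = mk⇔ (λ a⊏b → ⊥-elim (nth-All {j = j} (leftOf⇒¬ancestor-all a◁c c≺L) e a⊏b)) λ ()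

ancestor⇔≤blockEnd : ∀ {P k y a b} → Sorted P → nth P k ≡ just a → nth P y ≡ just b →
                     k < y → Ancestor a b ⇔ y ≤ k + count a P
ancestor⇔≤blockEnd {a ∷ L} {zero} {suc j} (a≺L ∷ sorted) refl e _
  rewrite count-reject L (ancestor-irrefl {a}) = ancestor⇔index<count sorted a≺L e
ancestor⇔≤blockEnd {x ∷ L} {suc k} {suc y} (x≺L ∷ sorted) e₁ e₂ (s<s k<y)
  rewrite count-reject L (precedes⇒¬ancestor˘ (nth-All {j = k} x≺L e₁))
  = mk⇔ (s≤s ∘ to IH) (from IH ∘ s≤s⁻¹)
  where IH = ancestor⇔≤blockEnd sorted e₁ e₂ k<y

blockEnd<length : ∀ {P k a} → Sorted P → nth P k ≡ just a → k + count a P < length P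
blockEnd<length {a ∷ L} {zero} _ refl
  rewrite count-reject L (ancestor-irrefl {a}) = s≤s (count≤length a L)
blockEnd<length {x ∷ L} {suc k} (x≺L ∷ sorted) e
  rewrite count-reject L (precedes⇒¬ancestor˘ (nth-All {j = k} x≺L e))
  = s<s (blockEnd<length sorted e)

leftOf⇒index< : ∀ {P k y a b} → Sorted P → nth P k ≡ just a → nth P y ≡ just b →
                LeftOf a b → k < y
leftOf⇒index< {k = k} {y} sorted e₁ e₂ a◁b with <-cmp k y
... | tri< k<y _ _ = k<y
... | tri≈ _ refl _ with trans (sym e₁) e₂
...   | refl = ⊥-elim (leftOf-irrefl a◁b)
leftOf⇒index< sorted e₁ e₂ a◁b | tri> _ _ y<k =
  ⊥-elim (precedes⇒¬leftOf˘ (nth-AllPairs sorted y<k e₂ e₁) a◁b)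

data StartsFrom (m : ℕ) : Addr → Set where
  start : ∀ {j r} → m ≤ j → StartsFrom m (j ∷ r)

preorderF-startsFrom : ∀ m ts → All (StartsFrom m) (preorderF m ts)
preorderF-startsFrom m []       = []
preorderF-startsFrom m (t ∷ ts) =
  All-++⁺ (All-map⁺ (All.tabulate λ _ → start ≤-refl))
          (All.map (λ { (start m<j) → start (<⇒≤ m<j) }) (preorderF-startsFrom (suc m) ts))

precedes-cons : ∀ {m a b} → Precedes a b → Precedes (m ∷ a) (m ∷ b)
precedes-cons (inj₁ p) = inj₁ (there p)
precedes-cons (inj₂ p) = inj₂ (there p)

mutual
  preorder-sorted : ∀ t → Sorted (preorder t)
  preorder-sorted (node ts) =
    All.map (λ { (start _) → inj₁ here }) (preorderF-startsFrom 0 ts) ∷ preorderF-sorted 0 ts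

  preorderF-sorted : ∀ m ts → Sorted (preorderF m ts)
  preorderF-sorted m []       = []
  preorderF-sorted m (t ∷ ts) =
    AllPairs-++⁺ (AllPairs-map⁺ (AllPairs.map precedes-cons (preorder-sorted t)))
                 (preorderF-sorted (suc m) ts)
                 (All-map⁺ (All.tabulate λ _ →
                    All.map (λ { (start m<j) → inj₂ (here m<j) }) (preorderF-startsFrom (suc m) ts)))

addrOf-defined : ∀ t {k} → k ≤ size t → ∃ λ a → addrOf t k ≡ just a
addrOf-defined (node ts) k≤n = nth-defined (preorder (node ts)) (s≤s k≤n)

addrOf⇒label≤size : ∀ t {k a} → addrOf t k ≡ just a → k ≤ size t
addrOf⇒label≤size (node ts) e = s≤s⁻¹ (nth-index< (preorder (node ts)) e)

descCount-addrOf : ∀ t {k a} → addrOf t k ≡ just a → descCount t k ≡ count a (preorder t)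
descCount-addrOf t = cong (maybe (λ a → count a (preorder t)) 0)

descCount-root : ∀ t → descCount t 0 ≡ size t
descCount-root (node ts) =
  cong length (filter-all (T? ∘ isProperAncestor [])
                          (All.map (λ { (start _) → _ }) (preorderF-startsFrom 0 ts)))

descCount-bound : ∀ t {k} → k ≤ size t → k + descCount t k ≤ size t
descCount-bound t@(node _) {k} k≤n =
  let _ , e = addrOf-defined t k≤n in
  subst (λ d → k + d ≤ size t) (sym (descCount-addrOf t {k} e))
        (s≤s⁻¹ (blockEnd<length (preorder-sorted t) e))

ρ⇒beyondSubtree : ∀ t {k y a} → addrOf t k ≡ just a → ρ t k y →
                  k + count a (preorder t) < y × y ≤ size t
ρ⇒beyondSubtree t eₖ (_ , b , eₖ′ , e_y , _ , _ , ¬a⊏b , _ , a◁b) with trans (sym eₖ) eₖ′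
... | refl = ≰⇒> (false⇒¬ancestor ¬a⊏b ∘ from (ancestor⇔≤blockEnd sorted eₖ e_y k<y))
           , addrOf⇒label≤size t e_y
  where
  sorted = preorder-sorted t
  k<y = leftOf⇒index< sorted eₖ e_y (true⇒leftOf a◁b)

beyondSubtree⇒ρ : ∀ t {k y a} → 1 ≤ k → addrOf t k ≡ just a →
                  k + count a (preorder t) < y → y ≤ size t → ρ t k y
beyondSubtree⇒ρ t {k} {y} {a} 1≤k eₖ end<y y≤n =
  let _ , e_y = addrOf-defined t y≤n in fromPrecedes e_y (nth-AllPairs sorted k<y eₖ e_y)
  where
  sorted = preorder-sorted t
  k<y : k < y
  k<y = ≤-<-trans (m≤m+n k _) end<y
  fromPrecedes : ∀ {b} → addrOf t y ≡ just b → Precedes a b → ρ t k y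
  fromPrecedes e_y (inj₁ a⊏b) =
    ⊥-elim (<⇒≱ end<y (to (ancestor⇔≤blockEnd sorted eₖ e_y k<y) a⊏b))
  fromPrecedes {b} e_y (inj₂ a◁b) =
    a , b , eₖ , e_y , 1≤k , ≤-trans 1≤k (<⇒≤ k<y) ,
    ¬ancestor⇒false (leftOf⇒¬ancestor a◁b) , ¬ancestor⇒false (leftOf⇒¬ancestor˘ a◁b) , leftOf⇒true a◁b

ρ⇔beyondSubtree : ∀ t {k y} → 1 ≤ k → k ≤ size t →
                  ρ t k y ⇔ (k + descCount t k < y × y ≤ size t)
ρ⇔beyondSubtree t {k} {y} 1≤k k≤n =
  let _ , eₖ = addrOf-defined t k≤n in
  subst (λ d → ρ t k y ⇔ (k + d < y × y ≤ size t)) (sym (descCount-addrOf t {k} eₖ))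
        (mk⇔ (ρ⇒beyondSubtree t eₖ) (uncurry (beyondSubtree⇒ρ t 1≤k eₖ)))

ρ⊇-from-descCount≤ : ∀ T₁ T₂ {k} → size T₂ ≡ size T₁ → 1 ≤ k → k ≤ size T₁ →
                     descCount T₁ k ≤ descCount T₂ k → ρ T₁ ⟨ k ⟩⊇ ρ T₂ ⟨ k ⟩
ρ⊇-from-descCount≤ T₁ T₂ {k} same 1≤k k≤n d₁≤d₂ y r₂ =
  let end₂<y , y≤n = to (ρ⇔beyondSubtree T₂ 1≤k (subst (k ≤_) (sym same) k≤n)) r₂ in
  from (ρ⇔beyondSubtree T₁ 1≤k k≤n) (≤-<-trans (+-monoʳ-≤ k d₁≤d₂) end₂<y , subst (y ≤_) same y≤n)

descCount≤-from-ρ⊇ : ∀ T₁ T₂ {k} → size T₂ ≡ size T₁ → 1 ≤ k → k ≤ size T₁ →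
                     ρ T₁ ⟨ k ⟩⊇ ρ T₂ ⟨ k ⟩ → descCount T₁ k ≤ descCount T₂ k
descCount≤-from-ρ⊇ T₁ T₂ {k} same 1≤k k≤n ρ⊇ = ≮⇒≥ λ d₂<d₁ →
  let -- the first label to the right of k's subtree in T₂ would lie inside it in T₁
      y≤n : suc (k + descCount T₂ k) ≤ size T₂
      y≤n = ≤-trans (+-monoʳ-< k d₂<d₁)
                    (subst (k + descCount T₁ k ≤_) (sym same) (descCount-bound T₁ k≤n))
      r₂ = from (ρ⇔beyondSubtree T₂ 1≤k (subst (k ≤_) (sym same) k≤n)) (≤-refl , y≤n)
      end₁<y , _ = to (ρ⇔beyondSubtree T₁ 1≤k k≤n) (ρ⊇ _ r₂)
  in <⇒≱ d₂<d₁ (+-cancelˡ-≤ k _ _ (s≤s⁻¹ end₁<y))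

mainTheorem7 : (n : ℕ) (T₁ T₂ : Tree) → size T₁ ≡ n → size T₂ ≡ n →
    (T₁ ≤T T₂) ⇔ (∀ k → 1 ≤ k → k ≤ n → ρ T₁ ⟨ k ⟩⊇ ρ T₂ ⟨ k ⟩)
mainTheorem7 n T₁ T₂ refl same = mk⇔
  (λ T₁≤T₂ k 1≤k k≤n → ρ⊇-from-descCount≤ T₁ T₂ same 1≤k k≤n (T₁≤T₂ k k≤n))
  λ where
    ρ⊇ zero    _   → ≤-reflexive (trans (descCount-root T₁) (sym (trans (descCount-root T₂) same)))
    ρ⊇ (suc k) k≤n → descCount≤-from-ρ⊇ T₁ T₂ same (s≤s z≤n) k≤n (ρ⊇ (suc k) (s≤s z≤n) k≤n)
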